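{- If $(\mathcal{C},\mathcal{K})$ is a connective island domain, then every admissible subfamily of $\mathcal{C}$ is CDW-independent.
   Context: An island domain is a pair $(\mathcal{C},\mathcal{K})$ where $U$ is a nonempty finite set and $\mathcal{C}\subseteq\mathcal{K}\subseteq\mathcal{P}(U)$ with $U\in\mathcal{C}$. It is connective if for all $A,B\in\mathcal{C}$ with $A\cap B\neq\emptyset$ and $B\not\subseteq A$ there exists $K\in\mathcal{K}$ with $A\subsetneq K\subseteq A\cup B$. A family $\mathcal{H}\subseteq\mathcal{C}\setminus\{\emptyset\}$ with $U\in\mathcal{H}$ is admissible if for every nonempty antichain $\mathcal{A}\subseteq\mathcal{H}$ there is $H\in\mathcal{A}$ such that for all $K\in\mathcal{K}$, $H\subsetneq K$ implies $K\not\subseteq\bigcup\mathcal{A}$. A family $\mathcal{H}\subseteq\mathcal{P}(U)$ is CD-independent if any two members are comparable or disjoint; it is weakly independent if whenever $H\in\mathcal{H}$ and $H_i\in\mathcal{H}$ ($i\in I$, $I$ a nonempty index set) satisfy $H\subseteq\bigcup_{i\in I}H_i$, then $H\subseteq H_i$ for some $i\in I$; it is CDW-independent if it is both CD-independent and weakly independent. -}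

module Defs where

open import Level using (0ℓ)
open import Data.Nat using (ℕ; suc)
open import Data.Fin.Subset using (Subset; _∈_; _⊆_; _⊂_; _∩_; _∪_; ⊤; Nonempty; Empty)
open import Data.Product using (Σ; ∃; _×_; _,_)
open import Data.Sum using (_⊎_)
open import Relation.Nullary using (¬_)
open import Relation.Binary.PropositionalEquality using (_≡_)

Family : ℕ → Set₁
Family n = Subset n → Set

_⊑_ : ∀ {n} → Family n → Family n → Set
𝒜 ⊑ ℬ = ∀ A → 𝒜 A → ℬ A

_⊆⋃_ : ∀ {n} → Subset n → Family n → Set
K ⊆⋃ 𝒜 = ∀ x → x ∈ K → ∃ λ A → 𝒜 A × x ∈ A

-- Island domain (𝒞,𝒦) on the nonempty finite set U = Fin (suc n)
record IslandDomain (n : ℕ) (𝒞 𝒦 : Family (suc n)) : Set where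
  field
    𝒞⊑𝒦  : 𝒞 ⊑ 𝒦
    U∈𝒞  : 𝒞 ⊤

Connective : ∀ {n} → Family n → Family n → Set
Connective 𝒞 𝒦 =
  ∀ A B → 𝒞 A → 𝒞 B → Nonempty (A ∩ B) → ¬ (B ⊆ A) →
  ∃ λ K → 𝒦 K × A ⊂ K × K ⊆ (A ∪ B)

Antichain : ∀ {n} → Family n → Set
Antichain 𝒜 = ∀ A B → 𝒜 A → 𝒜 B → A ⊆ B → A ≡ B

Admissible : ∀ {n} → Family (suc n) → Family (suc n) → Family (suc n) → Set₁
Admissible 𝒞 𝒦 ℋ =
  (ℋ ⊑ 𝒞) × (∀ H → ℋ H → Nonempty H) × ℋ ⊤ ×
  (∀ (𝒜 : Family _) → 𝒜 ⊑ ℋ → Antichain 𝒜 → (∃ λ A → 𝒜 A) →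
     ∃ λ H → 𝒜 H × (∀ K → 𝒦 K → H ⊂ K → ¬ (K ⊆⋃ 𝒜)))

CDIndependent : ∀ {n} → Family n → Set
CDIndependent ℋ =
  ∀ A B → ℋ A → ℋ B → A ⊆ B ⊎ B ⊆ A ⊎ Empty (A ∩ B)

WeaklyIndependent : ∀ {n} → Family n → Set₁
WeaklyIndependent {n} ℋ =
  ∀ H → ℋ H → (I : Set) → I → (Hᵢ : I → Subset n) → (∀ i → ℋ (Hᵢ i)) →
  (∀ x → x ∈ H → ∃ λ i → x ∈ Hᵢ i) →
  ∃ λ i → H ⊆ Hᵢ i

CDWIndependent : ∀ {n} → Family n → Set₁
CDWIndependent ℋ = CDIndependent ℋ × WeaklyIndependent ℋ

module Submission where

-- CD-independence: if A, B ∈ ℋ met without being comparable, then {A, B}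
-- would be an antichain in ℋ, and connectivity (applied to (A,B) and to
-- (B,A)) would enlarge EACH of its members by some K ∈ 𝒦 inside A ∪ B,
-- against admissibility.
--
-- Weak independence: admissibility forbids a member H of ℋ to be covered by
-- finitely many members of ℋ that are proper subsets of H: the maximal ones
-- among them form a nonempty antichain, each of whose members is enlarged by
-- H ∈ 𝒦 inside their union.  Given a cover of H by members Hᵢ of ℋ, we
-- extract a finite subcover (U is finite); if no Hᵢ in it contains H, then by
-- CD-independence every Hᵢ meeting H is a proper subset of H, a forbidden
-- cover.

open import Defs
open import Data.Nat using (ℕ; suc)
open import Data.Fin using (Fin)
open import Data.Fin.Subset using (Subset; _∈_; _∉_; _⊆_; _⊈_; _⊂_; _∩_; Nonempty)
open import Data.Fin.Subset.Properties
  using (_⊆?_; _∈?_; ⊆-refl; ⊆-trans; ⊆-antisym; x∈p∩q⁺; x∈p∩q⁻; x∈p∪q⁻)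
open import Data.Fin.Properties using (¬∀⟶∃¬)
open import Data.List using (List; []; _∷_; map; filter; allFin)
open import Data.List.Membership.Propositional using (find) renaming (_∈_ to _∈ₗ_)
open import Data.List.Membership.Propositional.Properties
  using (∈-map⁺; ∈-map⁻; ∈-filter⁺; ∈-filter⁻; ∈-allFin)
open import Data.List.Relation.Unary.Any using (here; there; any?)
open import Data.List.Relation.Unary.All using (lookup)
open import Data.List.Relation.Unary.All.Properties using (¬Any⇒All¬)
open import Data.Product using (∃; _×_; _,_; proj₁; proj₂)
open import Data.Sum using (_⊎_; inj₁; inj₂)
open import Data.Empty using (⊥-elim)
open import Relation.Nullary using (¬_; yes; no; contradiction)
open import Relation.Nullary.Decidable using (_→-dec_)
open import Relation.Binary.PropositionalEquality using (_≡_; refl)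

module _ {m : ℕ} where

  ⊈-witness : {p q : Subset m} → p ⊈ q → ∃ λ x → x ∈ p × x ∉ q
  ⊈-witness {p} {q} p⊈q
    with ¬∀⟶∃¬ m _ (λ x → x ∈? p →-dec x ∈? q) (λ incl → p⊈q (λ {x} → incl x))
  ... | x , ¬incl with x ∈? p
  ...   | yes x∈p = x , x∈p , λ x∈q → ¬incl (λ _ → x∈q)
  ...   | no x∉p = contradiction (λ x∈p → contradiction x∈p x∉p) ¬incl

  ⊆∧⊉⇒⊂ : {p q : Subset m} → p ⊆ q → q ⊈ p → p ⊂ q
  ⊆∧⊉⇒⊂ p⊆q q⊈p = p⊆q , ⊈-witness q⊈p

  meets-sym : {p q : Subset m} → Nonempty (p ∩ q) → Nonempty (q ∩ p)
  meets-sym {p} {q} (x , x∈p∩q) =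
    let x∈p , x∈q = x∈p∩q⁻ p q x∈p∩q in x , x∈p∩q⁺ (x∈q , x∈p)

  Maximal : List (Subset m) → Family m
  Maximal L X = X ∈ₗ L × (∀ Y → Y ∈ₗ L → X ⊆ Y → Y ⊆ X)

  maximal-above : (X : Subset m) (L : List (Subset m)) →
    ∃ λ Y → (Y ≡ X ⊎ Y ∈ₗ L) × X ⊆ Y × (∀ Z → Z ∈ₗ L → Y ⊆ Z → Z ⊆ Y)
  maximal-above X [] = X , inj₁ refl , ⊆-refl , λ _ ()
  maximal-above X (Z ∷ L) with X ⊆? Z
  ... | yes X⊆Z =
    let Y , origin , Z⊆Y , max = maximal-above Z L
    in Y , inj₂ (from-Z origin) , ⊆-trans X⊆Z Z⊆Y , extend Z⊆Y max
    where
    from-Z : ∀ {Y} → Y ≡ Z ⊎ Y ∈ₗ L → Y ∈ₗ Z ∷ L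
    from-Z (inj₁ refl) = here refl
    from-Z (inj₂ Y∈L) = there Y∈L
    extend : ∀ {Y} → Z ⊆ Y → (∀ W → W ∈ₗ L → Y ⊆ W → W ⊆ Y) →
             ∀ W → W ∈ₗ Z ∷ L → Y ⊆ W → W ⊆ Y
    extend Z⊆Y _ W (here refl) _ = Z⊆Y
    extend _ max W (there W∈L) = max W W∈L
  ... | no X⊈Z =
    let Y , origin , X⊆Y , max = maximal-above X L
    in Y , extend-origin origin , X⊆Y , extend X⊆Y max
    where
    extend-origin : ∀ {Y} → Y ≡ X ⊎ Y ∈ₗ L → Y ≡ X ⊎ Y ∈ₗ Z ∷ L
    extend-origin (inj₁ Y≡X) = inj₁ Y≡X
    extend-origin (inj₂ Y∈L) = inj₂ (there Y∈L)
    extend : ∀ {Y} → X ⊆ Y → (∀ W → W ∈ₗ L → Y ⊆ W → W ⊆ Y) →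
             ∀ W → W ∈ₗ Z ∷ L → Y ⊆ W → W ⊆ Y
    extend X⊆Y _ W (here refl) Y⊆Z = ⊥-elim (X⊈Z (⊆-trans X⊆Y Y⊆Z))
    extend _ max W (there W∈L) = max W W∈L

  below-maximal : {X : Subset m} (L : List (Subset m)) → X ∈ₗ L →
    ∃ λ Y → Maximal L Y × X ⊆ Y
  below-maximal {X} L X∈L with maximal-above X L
  ... | Y , inj₁ refl , X⊆Y , max = Y , (X∈L , max) , X⊆Y
  ... | Y , inj₂ Y∈L , X⊆Y , max = Y , (Y∈L , max) , X⊆Y

  maximal-antichain : (L : List (Subset m)) → Antichain (Maximal L)
  maximal-antichain L X Y (_ , maxX) (Y∈L , _) X⊆Y = ⊆-antisym X⊆Y (maxX Y Y∈L X⊆Y)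

  maximal-cover : {K : Subset m} (L : List (Subset m)) →
    K ⊆⋃ (_∈ₗ L) → K ⊆⋃ Maximal L
  maximal-cover L cover x x∈K with cover x x∈K
  ... | X , X∈L , x∈X with below-maximal L X∈L
  ...   | Y , maxY , X⊆Y = Y , maxY , X⊆Y x∈X

  finite-subcover : {I : Set} (Hᵢ : I → Subset m) (H : Subset m) →
    (∀ x → x ∈ H → ∃ λ i → x ∈ Hᵢ i) →
    ∃ λ (L : List I) → ∀ x → x ∈ H → ∃ λ i → i ∈ₗ L × x ∈ Hᵢ i
  finite-subcover {I} Hᵢ H cover =
    let L , covers = subcover-of (allFin m)
    in L , λ x x∈H → covers x (∈-allFin x) x∈H
    where
    subcover-of : (xs : List (Fin m)) →
      ∃ λ (L : List I) → ∀ x → x ∈ₗ xs → x ∈ H → ∃ λ i → i ∈ₗ L × x ∈ Hᵢ i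
    subcover-of [] = [] , λ _ ()
    subcover-of (y ∷ ys) with subcover-of ys | y ∈? H
    ... | L , covers | no y∉H = L , covers′
      where
      covers′ : ∀ x → x ∈ₗ y ∷ ys → x ∈ H → ∃ λ i → i ∈ₗ L × x ∈ Hᵢ i
      covers′ x (here refl) x∈H = contradiction x∈H y∉H
      covers′ x (there x∈ys) = covers x x∈ys
    ... | L , covers | yes y∈H = proj₁ (cover y y∈H) ∷ L , covers′
      where
      covers′ : ∀ x → x ∈ₗ y ∷ ys → x ∈ H → ∃ λ i → i ∈ₗ proj₁ (cover y y∈H) ∷ L × x ∈ Hᵢ i
      covers′ x (here refl) _ = proj₁ (cover y y∈H) , here refl , proj₂ (cover y y∈H)
      covers′ x (there x∈ys) x∈H =
        let i , i∈L , x∈Hᵢ = covers x x∈ys x∈H in i , there i∈L , x∈Hᵢ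

module _ {n : ℕ} {𝒞 𝒦 ℋ : Family (suc n)} (adm : Admissible 𝒞 𝒦 ℋ) where

  private
    ℋ⊑𝒞 : ℋ ⊑ 𝒞
    ℋ⊑𝒞 = proj₁ adm
    ℋ-nonempty : ∀ H → ℋ H → Nonempty H
    ℋ-nonempty = proj₁ (proj₂ adm)
    unenlargeable : ∀ (𝒜 : Family (suc n)) → 𝒜 ⊑ ℋ → Antichain 𝒜 → ∃ 𝒜 →
      ∃ λ G → 𝒜 G × (∀ K → 𝒦 K → G ⊂ K → ¬ (K ⊆⋃ 𝒜))
    unenlargeable = proj₂ (proj₂ (proj₂ adm))

  Pair : Subset (suc n) → Subset (suc n) → Family (suc n)
  Pair A B X = X ≡ A ⊎ X ≡ B

  connective-enlarges : Connective 𝒞 𝒦 → {𝒜 : Family (suc n)} {A B : Subset (suc n)} →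
    𝒞 A → 𝒞 B → Nonempty (A ∩ B) → B ⊈ A → 𝒜 A → 𝒜 B →
    ∃ λ K → 𝒦 K × A ⊂ K × K ⊆⋃ 𝒜
  connective-enlarges conn {A = A} {B} A∈𝒞 B∈𝒞 meet B⊈A A∈𝒜 B∈𝒜
    with conn A B A∈𝒞 B∈𝒞 meet B⊈A
  ... | K , K∈𝒦 , A⊂K , K⊆A∪B = K , K∈𝒦 , A⊂K , covered
    where
    covered : K ⊆⋃ _
    covered x x∈K with x∈p∪q⁻ A B (K⊆A∪B x∈K)
    ... | inj₁ x∈A = A , A∈𝒜 , x∈A
    ... | inj₂ x∈B = B , B∈𝒜 , x∈B

  cd-independent : Connective 𝒞 𝒦 → CDIndependent ℋ
  cd-independent conn A B A∈ℋ B∈ℋ with A ⊆? B | B ⊆? A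
  ... | yes A⊆B | _ = inj₁ A⊆B
  ... | no _ | yes B⊆A = inj₂ (inj₁ B⊆A)
  ... | no A⊈B | no B⊈A = inj₂ (inj₂ disjoint)
    where
    pair⊑ℋ : Pair A B ⊑ ℋ
    pair⊑ℋ X (inj₁ refl) = A∈ℋ
    pair⊑ℋ X (inj₂ refl) = B∈ℋ
    pair-antichain : Antichain (Pair A B)
    pair-antichain X Y (inj₁ refl) (inj₁ refl) _ = refl
    pair-antichain X Y (inj₂ refl) (inj₂ refl) _ = refl
    pair-antichain X Y (inj₁ refl) (inj₂ refl) A⊆B = ⊥-elim (A⊈B A⊆B)
    pair-antichain X Y (inj₂ refl) (inj₁ refl) B⊆A = ⊥-elim (B⊈A B⊆A)
    disjoint : ¬ Nonempty (A ∩ B)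
    disjoint meet with unenlargeable (Pair A B) pair⊑ℋ pair-antichain (A , inj₁ refl)
    ... | _ , inj₁ refl , stuck =
      let K , K∈𝒦 , A⊂K , K⊆⋃ = connective-enlarges conn (ℋ⊑𝒞 A A∈ℋ) (ℋ⊑𝒞 B B∈ℋ)
                                  meet B⊈A (inj₁ refl) (inj₂ refl)
      in stuck K K∈𝒦 A⊂K K⊆⋃
    ... | _ , inj₂ refl , stuck =
      let K , K∈𝒦 , B⊂K , K⊆⋃ = connective-enlarges conn (ℋ⊑𝒞 B B∈ℋ) (ℋ⊑𝒞 A A∈ℋ)
                                  (meets-sym meet) A⊈B (inj₂ refl) (inj₁ refl)
      in stuck K K∈𝒦 B⊂K K⊆⋃

  no-proper-cover : {H : Subset (suc n)} → ℋ H → 𝒦 H → (L : List (Subset (suc n))) →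
    (∀ {X} → X ∈ₗ L → ℋ X) → (∀ {X} → X ∈ₗ L → X ⊂ H) → ¬ (H ⊆⋃ (_∈ₗ L))
  no-proper-cover {H} H∈ℋ H∈𝒦 L L⊆ℋ L⊂H cover
    with unenlargeable (Maximal L) maximal⊑ℋ (maximal-antichain L) some-maximal
    where
    maximal⊑ℋ : Maximal L ⊑ ℋ
    maximal⊑ℋ X (X∈L , _) = L⊆ℋ X∈L
    some-maximal : ∃ (Maximal L)
    some-maximal =
      let x , x∈H = ℋ-nonempty H H∈ℋ
          X , maxX , _ = maximal-cover L cover x x∈H
      in X , maxX
  ... | G , (G∈L , _) , stuck = stuck H H∈𝒦 (L⊂H G∈L) (maximal-cover L cover)

  finite-weak-independence : Connective 𝒞 𝒦 → {H : Subset (suc n)} → ℋ H → 𝒦 H →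
    (L : List (Subset (suc n))) → (∀ {X} → X ∈ₗ L → ℋ X) → H ⊆⋃ (_∈ₗ L) →
    ∃ λ X → X ∈ₗ L × H ⊆ X
  finite-weak-independence conn {H} H∈ℋ H∈𝒦 L L⊆ℋ cover with any? (H ⊆?_) L
  ... | yes some = find some
  ... | no none = ⊥-elim (no-proper-cover H∈ℋ H∈𝒦 inner inner⊆ℋ inner⊂H inner-cover)
    where
    H⊈L : ∀ {X} → X ∈ₗ L → H ⊈ X
    H⊈L = lookup (¬Any⇒All¬ L none)
    inner : List (Subset (suc n))
    inner = filter (_⊆? H) L
    inner⊆ℋ : ∀ {X} → X ∈ₗ inner → ℋ X
    inner⊆ℋ X∈inner = L⊆ℋ (proj₁ (∈-filter⁻ (_⊆? H) X∈inner))
    inner⊂H : ∀ {X} → X ∈ₗ inner → X ⊂ H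
    inner⊂H X∈inner =
      let X∈L , X⊆H = ∈-filter⁻ (_⊆? H) X∈inner
      in ⊆∧⊉⇒⊂ X⊆H (H⊈L X∈L)
    -- by CD-independence, the members meeting H lie inside it
    inner-cover : H ⊆⋃ (_∈ₗ inner)
    inner-cover x x∈H with cover x x∈H
    ... | X , X∈L , x∈X with cd-independent conn H X H∈ℋ (L⊆ℋ X∈L)
    ...   | inj₁ H⊆X = ⊥-elim (H⊈L X∈L H⊆X)
    ...   | inj₂ (inj₁ X⊆H) = X , ∈-filter⁺ (_⊆? H) X∈L X⊆H , x∈X
    ...   | inj₂ (inj₂ disjoint) = contradiction (x , x∈p∩q⁺ (x∈H , x∈X)) disjoint

  weak-independence : IslandDomain n 𝒞 𝒦 → Connective 𝒞 𝒦 → WeaklyIndependent ℋ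
  weak-independence isl conn H H∈ℋ I _ Hᵢ Hᵢ∈ℋ cover
    with finite-subcover Hᵢ H cover
  ... | J , J-covers
    with finite-weak-independence conn H∈ℋ (IslandDomain.𝒞⊑𝒦 isl H (ℋ⊑𝒞 H H∈ℋ))
           (map Hᵢ J) members covers
    where
    members : ∀ {X} → X ∈ₗ map Hᵢ J → ℋ X
    members X∈ with ∈-map⁻ Hᵢ X∈
    ... | i , _ , refl = Hᵢ∈ℋ i
    covers : H ⊆⋃ (_∈ₗ map Hᵢ J)
    covers x x∈H =
      let i , i∈J , x∈Hᵢ = J-covers x x∈H in Hᵢ i , ∈-map⁺ Hᵢ i∈J , x∈Hᵢ
  ... | X , X∈ , H⊆X with ∈-map⁻ Hᵢ X∈
  ...   | i , _ , refl = i , H⊆X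

lemma4p6 : (n : ℕ) (𝒞 𝒦 : Family (suc n)) → IslandDomain n 𝒞 𝒦 → Connective 𝒞 𝒦 →
    (ℋ : Family (suc n)) → Admissible 𝒞 𝒦 ℋ → CDWIndependent ℋ
lemma4p6 n 𝒞 𝒦 isl conn ℋ adm = cd-independent adm conn , weak-independence adm isl conn
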